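{- Let $f \in \mathrm{Inc}^q(P)$ and $\overline{f}$ be $r$-packed. If the first entry in $\mathrm{Con}(f)$ is $1$, we have $\overline{\mathrm{Pro}(f)} = \mathrm{Pro}(\overline{f})$. Otherwise, we have $\overline{\mathrm{Pro}(f)} = \overline{f}$.
   Context: $P$ is a finite poset. $\mathrm{Inc}^q(P)$ is the set of increasing labelings $f:P\to[q]$ ($f(x)<f(y)$ whenever $x<y$). Promotion $\mathrm{Pro}$ on $\mathrm{Inc}^q(P)$: replace labels $1$ by empty boxes; for $i=2,\dots,q$ slide boxes upward (a box at $x$ becomes $i$ if some $y\gtrdot x$ is labeled $i$, and an element labeled $i$ covering a box becomes a box); replace boxes by $q+1$ and subtract $1$ from all labels ($\mathrm{Pro}(\overline{f})$ is computed in $\mathrm{Inc}^r(P)$). $\mathrm{Con}(f)=(c_1,\dots,c_q)$ with $c_i=1$ iff label $i$ is used. The deflation $\overline{f}$ replaces the $j$-th smallest label used by $f$ with $j$; $\overline{f}$ is $r$-packed if it takes values in $[r]$ with $r$ minimal (i.e. $f$ uses exactly $r$ distinct labels). -}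

module Defs where

open import Data.Nat using (ℕ; zero; suc; _≤_; _∸_; _<_)
open import Data.Nat.Properties using (_≟_; _≤?_)
open import Data.Fin using (Fin)
open import Data.List using (List; allFin; filter; length; upTo; map)
open import Data.Bool.ListAction using (any)
open import Data.Bool using (Bool; true; false; _∧_; not; if_then_else_)
open import Data.Maybe using (Maybe; just; nothing; maybe)
open import Data.Product using (Σ; _×_; _,_)
open import Relation.Nullary using (¬_; Dec; yes; no)
open import Relation.Nullary.Decidable using (⌊_⌋)
open import Relation.Binary using (Rel; IsStrictPartialOrder; Decidable)
open import Relation.Binary.PropositionalEquality using (_≡_)
open import Level using (0ℓ)

record FinPoset (n : ℕ) : Set₁ where
  field
    _<ₚ_ : Rel (Fin n) 0ℓ
    isSPO : IsStrictPartialOrder _≡_ _<ₚ_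
    _<ₚ?_ : Decidable _<ₚ_

open FinPoset public

module _ {n : ℕ} (P : FinPoset n) where

  private
    lt : Fin n → Fin n → Bool
    lt x y = ⌊ _<ₚ?_ P x y ⌋

  covers : Fin n → Fin n → Bool
  covers x y = lt x y ∧ not (any (λ z → lt x z ∧ lt z y) (allFin n))

  Inc : ℕ → (Fin n → ℕ) → Set
  Inc q f = (∀ x → 1 ≤ f x × f x ≤ q) × (∀ x y → _<ₚ_ P x y → f x < f y)

  usedB : (Fin n → ℕ) → ℕ → Bool
  usedB f k = any (λ y → ⌊ f y ≟ k ⌋) (allFin n)

  Used : (Fin n → ℕ) → ℕ → Set
  Used f k = usedB f k ≡ true

  oneTo : ℕ → List ℕ
  oneTo m = map suc (upTo m)

  numUsed : ℕ → (Fin n → ℕ) → ℕ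
  numUsed q f = length (filter (λ k → usedB f k Data.Bool.≟ true) (oneTo q))

  -- deflation: the j-th smallest used label becomes j, i.e.
  -- deflate f x = #{ used labels k with k ≤ f x }
  deflate : (Fin n → ℕ) → Fin n → ℕ
  deflate f x = length (filter (λ k → usedB f k Data.Bool.≟ true) (oneTo (f x)))

  -- promotion; a state assigns to each element a label (just v) or a box (nothing)
  State : Set
  State = Fin n → Maybe ℕ

  private
    isLabel : Maybe ℕ → ℕ → Bool
    isLabel (just v) i = ⌊ v ≟ i ⌋
    isLabel nothing i = false

    isBox : Maybe ℕ → Bool
    isBox (just _) = false
    isBox nothing = true

  slideStep : ℕ → State → State
  slideStep i s x with s x
  ... | nothing = if any (λ y → covers x y ∧ isLabel (s y) i) (allFin n) then just i else nothing
  ... | just v = if ⌊ v ≟ i ⌋ ∧ any (λ z → covers z x ∧ isBox (s z)) (allFin n) then nothing else just v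

  slides : ℕ → State → State
  slides zero s = s
  slides (suc zero) s = s
  slides (suc (suc k)) s = slideStep (suc (suc k)) (slides (suc k) s)

  Pro : ℕ → (Fin n → ℕ) → Fin n → ℕ
  Pro q f x = maybe (λ v → v ∸ 1) q (slides q init x)
    where
    init : State
    init y = if ⌊ f y ≟ 1 ⌋ then nothing else just (f y)

{-# OPTIONS --safe #-}
module Submission where

-- Let rank k be the number of labels in [1, k] used by f, so that the deflation of f is rank ∘ f.
-- A slide for a label i not used by f moves nothing, while a slide for a used label i commutes
-- with relabelling by rank, because rank is injective on used labels. If f uses 1 then
-- rank 1 = 1, so the initial states of promotion on f and on its deflation correspond under rank,
-- and hence so do the final states. Moreover Pro f uses k < q exactly when f uses k + 1, and uses
-- q exactly when a box survives; counting used labels then turns the deflation of Pro f into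
-- Pro of the deflation. If f does not use 1 there is no box, nothing slides, and Pro f = f − 1
-- has the same deflation as f.

open import Defs
open import Data.Bool using (Bool; true; false; _∧_; if_then_else_)
import Data.Bool as Bool
open import Data.Bool.ListAction using (any; or)
open import Data.Bool.Properties using (T-≡; ¬-not; if-float; ∧-conicalˡ; ∧-conicalʳ)
open import Data.Empty using (⊥-elim)
open import Data.Fin using (Fin)
open import Data.List using ([_]; _++_; allFin; filter; length; upTo; applyUpTo; map)
open import Data.List.Membership.Propositional using (_∈_; lose)
open import Data.List.Membership.Propositional.Properties using (∈-allFin)
open import Data.List.Properties using (map-cong; map-upTo; applyUpTo-∷ʳ; filter-++; length-++)
open import Data.List.Relation.Unary.Any using (satisfied)
open import Data.List.Relation.Unary.Any.Properties using (any⁺; any⁻)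
open import Data.Maybe using (Maybe; just; nothing; maybe)
import Data.Maybe as Maybe
import Data.Maybe.Properties as Maybe
open import Data.Nat
  using (ℕ; zero; suc; _∸_; _+_; _≤_; _<_; _≥_; _≤′_; ≤′-refl; ≤′-step; z≤n; s≤s)
open import Data.Nat.Properties
  using ( _≟_; suc-injective; ≤-refl; ≤-trans; ≤-reflexive; ≤-<-trans; n≤1+n; m≤n⇒m≤1+n
        ; ≤⇒≤′; <-cmp; <-irrefl; +-comm; +-suc; +-identityʳ; m+[n∸m]≡n)
open import Data.Product using (_×_; ∃-syntax; _,_; proj₁; proj₂; map₂)
open import Function using (_∘_; _⇔_; mk⇔; Equivalence)
open import Relation.Binary.Definitions using (tri<; tri≈; tri>)
open import Relation.Binary.PropositionalEquality
  using (_≡_; refl; sym; trans; subst; cong; cong₂; _≗_; module ≡-Reasoning)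
open import Relation.Nullary using (¬_; Dec; yes; no)
open import Relation.Nullary.Decidable using (⌊_⌋; toWitness; does-⇔; isYes≗does; dec-true)

open Equivalence using (to; from)
open ≡-Reasoning

any-witness : ∀ {A : Set} (p : A → Bool) xs → any p xs ≡ true → ∃[ x ] p x ≡ true
any-witness p xs e = map₂ (to T-≡) (satisfied (any⁻ p xs (from T-≡ e)))

any-intro : ∀ {A : Set} (p : A → Bool) {xs} {x : A} → x ∈ xs → p x ≡ true → any p xs ≡ true
any-intro p x∈xs e = to T-≡ (any⁺ p (lose x∈xs (from T-≡ e)))

any-false : ∀ {A : Set} (p : A → Bool) xs → (∀ x → ¬ p x ≡ true) → any p xs ≡ false
any-false p xs none = ¬-not (λ e → let x , px = any-witness p xs e in none x px)

any-cong : ∀ {A : Set} {p p′ : A → Bool} → p ≗ p′ → any p ≗ any p′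
any-cong p≗p′ xs = cong or (map-cong p≗p′ xs)

≡true-ext : ∀ {a b : Bool} → (a ≡ true ⇔ b ≡ true) → a ≡ b
≡true-ext {true}          a⇔b = sym (to a⇔b refl)
≡true-ext {false} {true}  a⇔b = from a⇔b refl
≡true-ext {false} {false} _   = refl

⌊⌋-⇔ : ∀ {A B : Set} → A ⇔ B → (a? : Dec A) (b? : Dec B) → ⌊ a? ⌋ ≡ ⌊ b? ⌋
⌊⌋-⇔ A⇔B a? b? = trans (isYes≗does a?) (trans (does-⇔ A⇔B a? b?) (sym (isYes≗does b?)))

⌊≟⌋-true : ∀ {a b} → ⌊ a ≟ b ⌋ ≡ true → a ≡ b
⌊≟⌋-true e = toWitness (from T-≡ e)

⌊≟⌋-refl : ∀ a → ⌊ a ≟ a ⌋ ≡ true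
⌊≟⌋-refl a = trans (isYes≗does (a ≟ a)) (dec-true (a ≟ a) refl)

countUpTo : (ℕ → Bool) → ℕ → ℕ
countUpTo b zero    = 0
countUpTo b (suc m) = if b (suc m) then suc (countUpTo b m) else countUpTo b m

length-filter-oneTo : ∀ b m →
  length (filter (λ k → b k Bool.≟ true) (map suc (upTo m))) ≡ countUpTo b m
length-filter-oneTo b zero    = refl
length-filter-oneTo b (suc m) = begin
    count (map suc (upTo (suc m)))
  ≡⟨ cong count (trans (map-upTo suc (suc m)) (sym (applyUpTo-∷ʳ suc m))) ⟩
    count (applyUpTo suc m ++ [ suc m ])
  ≡⟨ cong length (filter-++ b? (applyUpTo suc m) [ suc m ]) ⟩
    length (filter b? (applyUpTo suc m) ++ filter b? [ suc m ])
  ≡⟨ length-++ (filter b? (applyUpTo suc m)) ⟩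
    count (applyUpTo suc m) + count [ suc m ]
  ≡⟨ cong (λ xs → count xs + count [ suc m ]) (sym (map-upTo suc m)) ⟩
    count (map suc (upTo m)) + count [ suc m ]
  ≡⟨ cong (_+ count [ suc m ]) (length-filter-oneTo b m) ⟩
    countUpTo b m + count [ suc m ]
  ≡⟨ add-last ⟩
    countUpTo b (suc m)
  ∎
  where
  b? = λ k → b k Bool.≟ true
  count = λ xs → length (filter b? xs)
  add-last : countUpTo b m + count [ suc m ] ≡ countUpTo b (suc m)
  add-last with b (suc m)
  ... | true  = +-comm (countUpTo b m) 1
  ... | false = +-identityʳ (countUpTo b m)

module _ (b : ℕ → Bool) where

  countUpTo-suc-true : ∀ {m} → b (suc m) ≡ true → countUpTo b (suc m) ≡ suc (countUpTo b m)
  countUpTo-suc-true e rewrite e = refl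

  countUpTo-suc-false : ∀ {m} → b (suc m) ≡ false → countUpTo b (suc m) ≡ countUpTo b m
  countUpTo-suc-false e rewrite e = refl

  countUpTo-≤-suc : ∀ m → countUpTo b m ≤ countUpTo b (suc m)
  countUpTo-≤-suc m with b (suc m)
  ... | true  = n≤1+n (countUpTo b m)
  ... | false = ≤-refl

  countUpTo-mono : ∀ {m m′} → m ≤ m′ → countUpTo b m ≤ countUpTo b m′
  countUpTo-mono = mono′ ∘ ≤⇒≤′
    where
    mono′ : ∀ {m m′} → m ≤′ m′ → countUpTo b m ≤ countUpTo b m′
    mono′ ≤′-refl        = ≤-refl
    mono′ (≤′-step m≤m′) = ≤-trans (mono′ m≤m′) (countUpTo-≤-suc _)

  countUpTo-positive : b 1 ≡ true → ∀ m → countUpTo b (suc m) ≥ 1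
  countUpTo-positive b1 m =
    ≤-trans (≤-reflexive (sym (countUpTo-suc-true b1))) (countUpTo-mono (s≤s z≤n))

  countUpTo-< : ∀ {m m′} → m < m′ → b m′ ≡ true → countUpTo b m < countUpTo b m′
  countUpTo-< (s≤s m≤m′) e rewrite e = s≤s (countUpTo-mono m≤m′)

  countUpTo-injective : ∀ {m m′} → b m ≡ true → b m′ ≡ true →
                        countUpTo b m ≡ countUpTo b m′ → m ≡ m′
  countUpTo-injective {m} {m′} bm bm′ eq with <-cmp m m′
  ... | tri< m<m′ _ _ = ⊥-elim (<-irrefl eq (countUpTo-< m<m′ bm′))
  ... | tri≈ _ m≡m′ _ = m≡m′
  ... | tri> _ _ m>m′ = ⊥-elim (<-irrefl (sym eq) (countUpTo-< m>m′ bm))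

countUpTo-shift : ∀ (b c : ℕ → Bool) m → (∀ k → 1 ≤ k → k ≤ m → b k ≡ c (suc k)) →
                  countUpTo c 1 + countUpTo b m ≡ countUpTo c (suc m)
countUpTo-shift b c zero    _     = +-identityʳ (countUpTo c 1)
countUpTo-shift b c (suc m) agree
  with countUpTo-shift b c m (λ k 1≤k k≤m → agree k 1≤k (m≤n⇒m≤1+n k≤m))
... | shift rewrite agree (suc m) (s≤s z≤n) ≤-refl with c (suc (suc m))
...   | true  = trans (+-suc (countUpTo c 1) (countUpTo b m)) (cong suc shift)
...   | false = shift

initialContent : ℕ → Maybe ℕ
initialContent v = if ⌊ v ≟ 1 ⌋ then nothing else just v

initialContent-just : ∀ {v w} → initialContent v ≡ just w → v ≡ w
initialContent-just {v} e with v ≟ 1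
... | no _ = Maybe.just-injective e
... | yes _ with () ← e

initialContent-≢1 : ∀ {v} → ¬ v ≡ 1 → initialContent v ≡ just v
initialContent-≢1 {v} v≢1 with v ≟ 1
... | no _    = refl
... | yes v≡1 = ⊥-elim (v≢1 v≡1)

initialContent-relabel : ∀ (φ : ℕ → ℕ) {v} → (φ v ≡ 1 ⇔ v ≡ 1) →
                         initialContent (φ v) ≡ Maybe.map φ (initialContent v)
initialContent-relabel φ {v} φv≡1⇔v≡1 = trans
  (cong (λ c → if c then nothing else just (φ v)) (⌊⌋-⇔ φv≡1⇔v≡1 (φ v ≟ 1) (v ≟ 1)))
  (sym (if-float (Maybe.map φ) ⌊ v ≟ 1 ⌋))

module _ {n : ℕ} (P : FinPoset n) where

  -- The label and box tests performed by slideStep are private to Defs; these two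
  -- metavariables name them, being solved by unification in slideStep-slideAt.
  mutual
    hasLabel : State P → Fin n → ℕ → Bool
    hasLabel = _

    isBox : State P → Fin n → Bool
    isBox = _

    slideAt : ℕ → State P → Fin n → Maybe ℕ → Maybe ℕ
    slideAt i s x nothing  =
      if any (λ y → covers P x y ∧ hasLabel s y i) (allFin n) then just i else nothing
    slideAt i s x (just v) =
      if ⌊ v ≟ i ⌋ ∧ any (λ z → covers P z x ∧ isBox s z) (allFin n) then nothing else just v

    slideStep-slideAt : ∀ i s x → slideStep P i s x ≡ slideAt i s x (s x)
    slideStep-slideAt i s x with s x
    ... | nothing = refl
    ... | just v  = refl

  hasLabel-true : ∀ s y {i} → hasLabel s y i ≡ true → s y ≡ just i
  hasLabel-true s y e with s y
  ... | just v  = cong just (⌊≟⌋-true e)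
  ... | nothing with () ← e

  hasLabel-just : ∀ s y {i} → s y ≡ just i → hasLabel s y i ≡ true
  hasLabel-just s y {i} e rewrite e = ⌊≟⌋-refl i

  isBox-true : ∀ s y → isBox s y ≡ true → s y ≡ nothing
  isBox-true s y e with s y
  ... | nothing = refl
  ... | just _  with () ← e

  slideStep-at-box : ∀ {i} s {x} → s x ≡ nothing →
    slideStep P i s x ≡
      (if any (λ y → covers P x y ∧ hasLabel s y i) (allFin n) then just i else nothing)
  slideStep-at-box {i} s {x} sx = trans (slideStep-slideAt i s x) (cong (slideAt i s x) sx)

  slideStep-at-label : ∀ {i} s {x v} → s x ≡ just v →
    slideStep P i s x ≡
      (if ⌊ v ≟ i ⌋ ∧ any (λ z → covers P z x ∧ isBox s z) (allFin n) then nothing else just v)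
  slideStep-at-label {i} s {x} sx = trans (slideStep-slideAt i s x) (cong (slideAt i s x) sx)

  slideStep-label-source : ∀ {i} s {x w} → slideStep P i s x ≡ just w → ∃[ y ] s y ≡ just w
  slideStep-label-source {i} s {x} e = source (s x) refl (trans (sym (slideStep-slideAt i s x)) e)
    where
    source : ∀ {w} m → s x ≡ m → slideAt i s x m ≡ just w → ∃[ y ] s y ≡ just w
    source nothing _ e with any (λ y → covers P x y ∧ hasLabel s y i) (allFin n) in a
    ... | true  with refl ← e =
      let y , p = any-witness _ (allFin n) a in y , hasLabel-true s y (∧-conicalʳ (covers P x y) _ p)
    ... | false with () ← e
    source (just v) sx e with ⌊ v ≟ i ⌋ ∧ any (λ z → covers P z x ∧ isBox s z) (allFin n)
    ... | true  with () ← e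
    ... | false with refl ← e = x , sx

  slideStep-label-kept : ∀ i s {y j} → s y ≡ just j → ∃[ y′ ] slideStep P i s y′ ≡ just j
  slideStep-label-kept i s {y} {j} sy
    with ⌊ j ≟ i ⌋ ∧ any (λ z → covers P z y ∧ isBox s z) (allFin n) in moves
  ... | false = y , trans (slideStep-at-label s sy) (cong (λ c → if c then nothing else just j) moves)
  ... | true with refl ← ⌊≟⌋-true {j} {i} (∧-conicalˡ ⌊ j ≟ i ⌋ _ moves) =
    z , trans (slideStep-at-box s sz) (cong (λ c → if c then just j else nothing) fills)
    where
    z-below = any-witness _ (allFin n) (∧-conicalʳ ⌊ j ≟ j ⌋ _ moves)
    z = proj₁ z-below
    sz : s z ≡ nothing
    sz = isBox-true s z (∧-conicalʳ (covers P z y) _ (proj₂ z-below))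
    fills : any (λ y′ → covers P z y′ ∧ hasLabel s y′ j) (allFin n) ≡ true
    fills = any-intro _ (∈-allFin y)
      (cong₂ _∧_ (∧-conicalˡ (covers P z y) _ (proj₂ z-below)) (hasLabel-just s y sy))

  slideStep-idle : ∀ i {s} →
                   (∀ z y → covers P z y ≡ true → s z ≡ nothing → ¬ s y ≡ just i) →
                   slideStep P i s ≗ s
  slideStep-idle i {s} stuck x = trans (slideStep-slideAt i s x) (idle (s x) refl)
    where
    idle : ∀ m → s x ≡ m → slideAt i s x m ≡ m
    idle nothing sx = cong (λ c → if c then just i else nothing) (any-false _ (allFin n) λ y p →
      stuck x y (∧-conicalˡ (covers P x y) _ p) sx (hasLabel-true s y (∧-conicalʳ (covers P x y) _ p)))
    idle (just v) sx with v ≟ i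
    ... | no _     = refl
    ... | yes refl = cong (λ c → if c then nothing else just v) (any-false _ (allFin n) λ z p →
      stuck z x (∧-conicalˡ (covers P z x) _ p) (isBox-true s z (∧-conicalʳ (covers P z x) _ p)) sx)

  slideStep-relabel : ∀ (φ : ℕ → ℕ) i {s t} → (∀ y → t y ≡ Maybe.map φ (s y)) →
    (∀ y v → s y ≡ just v → φ v ≡ φ i → v ≡ i) →
    ∀ x → slideStep P (φ i) t x ≡ Maybe.map φ (slideStep P i s x)
  slideStep-relabel φ i {s} {t} t≗φs φ-inj x = begin
      slideStep P (φ i) t x                 ≡⟨ slideStep-slideAt (φ i) t x ⟩
      slideAt (φ i) t x (t x)               ≡⟨ cong (slideAt (φ i) t x) (t≗φs x) ⟩
      slideAt (φ i) t x (Maybe.map φ (s x)) ≡⟨ relabelAt (s x) refl ⟩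
      Maybe.map φ (slideAt i s x (s x))     ≡⟨ cong (Maybe.map φ) (slideStep-slideAt i s x) ⟨
      Maybe.map φ (slideStep P i s x)       ∎
    where
    ≟-relabel : ∀ {y v} → s y ≡ just v → ⌊ φ v ≟ φ i ⌋ ≡ ⌊ v ≟ i ⌋
    ≟-relabel {y} {v} sy = ⌊⌋-⇔ (mk⇔ (φ-inj y v sy) (cong φ)) (φ v ≟ φ i) (v ≟ i)

    hasLabel-relabel : ∀ y → hasLabel t y (φ i) ≡ hasLabel s y i
    hasLabel-relabel y rewrite t≗φs y with s y in sy
    ... | nothing = refl
    ... | just v  = ≟-relabel sy

    isBox-relabel : ∀ y → isBox t y ≡ isBox s y
    isBox-relabel y rewrite t≗φs y with s y
    ... | nothing = refl
    ... | just _  = refl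

    relabelAt : ∀ m → s x ≡ m → slideAt (φ i) t x (Maybe.map φ m) ≡ Maybe.map φ (slideAt i s x m)
    relabelAt nothing _ = trans
      (cong (λ c → if c then just (φ i) else nothing)
        (any-cong (λ y → cong (covers P x y ∧_) (hasLabel-relabel y)) (allFin n)))
      (sym (if-float (Maybe.map φ) (any (λ y → covers P x y ∧ hasLabel s y i) (allFin n))))
    relabelAt (just v) sx = trans
      (cong (λ c → if c then nothing else just (φ v))
        (cong₂ _∧_ (≟-relabel sx)
          (any-cong (λ z → cong (covers P z x ∧_) (isBox-relabel z)) (allFin n))))
      (sym (if-float (Maybe.map φ) (⌊ v ≟ i ⌋ ∧ any (λ z → covers P z x ∧ isBox s z) (allFin n))))

  slides-preserves : (Q : State P → Set) → (∀ i s → Q s → Q (slideStep P i s)) →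
                     ∀ k s → Q s → Q (slides P k s)
  slides-preserves Q step zero          s q = q
  slides-preserves Q step (suc zero)    s q = q
  slides-preserves Q step (suc (suc k)) s q = step (suc (suc k)) _ (slides-preserves Q step (suc k) s q)

  slides-suc : ∀ {m} s x → m ≥ 1 → slides P (suc m) s x ≡ slideStep P (suc m) (slides P m s) x
  slides-suc {suc m} s x _ = refl

  AllLabels : (ℕ → Set) → State P → Set
  AllLabels R s = ∀ y v → s y ≡ just v → R v

  slides-AllLabels : ∀ {R} k {s} → AllLabels R s → AllLabels R (slides P k s)
  slides-AllLabels {R} k = slides-preserves (AllLabels R)
    (λ i s labels y v e → let y′ , e′ = slideStep-label-source s e in labels y′ v e′) k _

  slides-label-kept : ∀ k {s y j} → s y ≡ just j → ∃[ y′ ] slides P k s y′ ≡ just j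
  slides-label-kept k {s} {y} sy = slides-preserves (λ s → ∃[ y′ ] s y′ ≡ _)
    (λ i s (y , sy) → slideStep-label-kept i s sy) k s (y , sy)

  slides-without-boxes : ∀ k {s} (h : Fin n → ℕ) → (∀ y → s y ≡ just (h y)) →
                         ∀ y → slides P k s y ≡ just (h y)
  slides-without-boxes k h = slides-preserves (λ s → ∀ y → s y ≡ just (h y)) fixed k _
    where
    fixed : ∀ i s → (∀ y → s y ≡ just (h y)) → ∀ y → slideStep P i s y ≡ just (h y)
    fixed i s labelled y = trans (slideStep-idle i (λ z _ _ sz _ → box-free z sz) y) (labelled y)
      where
      box-free : ∀ z → ¬ s z ≡ nothing
      box-free z sz with () ← trans (sym sz) (labelled z)

  slides-relabel : ∀ (b : ℕ → Bool) {s t} → b 1 ≡ true → AllLabels (λ v → b v ≡ true) s →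
    (∀ y → t y ≡ Maybe.map (countUpTo b) (s y)) →
    ∀ j y → slides P (countUpTo b j) t y ≡ Maybe.map (countUpTo b) (slides P j s y)
  slides-relabel b b1 labels t≗ρs zero = t≗ρs
  slides-relabel b b1 labels t≗ρs (suc zero) rewrite b1 = t≗ρs
  slides-relabel b {s} {t} b1 labels t≗ρs (suc (suc j)) y =
    slide (b (suc (suc j))) refl (slides-relabel b b1 labels t≗ρs (suc j))
    where
    ρ = countUpTo b
    i = suc (suc j)
    S = slides P (suc j) s
    T = slides P (ρ (suc j)) t

    S-labels : AllLabels (λ v → b v ≡ true) S
    S-labels = slides-AllLabels (suc j) labels

    slide : ∀ c → b i ≡ c → (∀ y → T y ≡ Maybe.map ρ (S y)) →
            slides P (ρ i) t y ≡ Maybe.map ρ (slideStep P i S y)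
    slide false unused T≗ρS = begin
        slides P (ρ i) t y               ≡⟨ cong (λ k → slides P k t y) (countUpTo-suc-false b unused) ⟩
        T y                              ≡⟨ T≗ρS y ⟩
        Maybe.map ρ (S y)                ≡⟨ cong (Maybe.map ρ) (slideStep-idle i absent y) ⟨
        Maybe.map ρ (slideStep P i S y)  ∎
      where
      absent : ∀ z y → covers P z y ≡ true → S z ≡ nothing → ¬ S y ≡ just i
      absent _ y _ _ Sy with () ← trans (sym (S-labels y i Sy)) unused
    slide true used T≗ρS = begin
        slides P (ρ i) t y                ≡⟨ cong (λ k → slides P k t y) (countUpTo-suc-true b used) ⟩
        slides P (suc (ρ (suc j))) t y    ≡⟨ slides-suc t y (countUpTo-positive b b1 j) ⟩
        slideStep P (suc (ρ (suc j))) T y ≡⟨ cong (λ k → slideStep P k T y) (countUpTo-suc-true b used) ⟨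
        slideStep P (ρ i) T y             ≡⟨ slideStep-relabel ρ i T≗ρS ρ-injective y ⟩
        Maybe.map ρ (slideStep P i S y)   ∎
      where
      ρ-injective : ∀ y v → S y ≡ just v → ρ v ≡ ρ i → v ≡ i
      ρ-injective y v Sy = countUpTo-injective b (S-labels y v Sy) used

  Pro-slides : ∀ q g x → Pro P q g x ≡ maybe (_∸ 1) q (slides P q (initialContent ∘ g) x)
  Pro-slides q g x = refl

  used-intro : ∀ g {y k} → g y ≡ k → Used P g k
  used-intro g {y} {k} e =
    any-intro _ (∈-allFin y) (trans (cong (λ v → ⌊ v ≟ k ⌋) e) (⌊≟⌋-refl k))

  used-elim : ∀ g {k} → Used P g k → ∃[ y ] g y ≡ k
  used-elim g u = map₂ ⌊≟⌋-true (any-witness _ (allFin n) u)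

  usedB-suc : ∀ {g h : Fin n → ℕ} → (∀ y → suc (g y) ≡ h y) →
              ∀ k → usedB P g k ≡ usedB P h (suc k)
  usedB-suc {g} {h} suc-g≡h k = ≡true-ext (mk⇔
    (λ u → let y , e = used-elim g u in used-intro h (trans (sym (suc-g≡h y)) (cong suc e)))
    (λ u → let y , e = used-elim h u in used-intro g (suc-injective (trans (suc-g≡h y) e))))

  deflate-countUpTo : ∀ g x → deflate P g x ≡ countUpTo (usedB P g) (g x)
  deflate-countUpTo g x = length-filter-oneTo (usedB P g) (g x)

  numUsed-countUpTo : ∀ m g → numUsed P m g ≡ countUpTo (usedB P g) m
  numUsed-countUpTo m g = length-filter-oneTo (usedB P g) m

module _ {n : ℕ} (P : FinPoset n) {q : ℕ} {f : Fin n → ℕ}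
         (bounded : ∀ x → 1 ≤ f x × f x ≤ q) where

  private
    rank : ℕ → ℕ
    rank = countUpTo (usedB P f)

    S : State P
    S = slides P q (initialContent ∘ f)

    g : Fin n → ℕ
    g = Pro P q f

  used-bounded : ∀ {k} → Used P f k → 1 ≤ k × k ≤ q
  used-bounded u = let y , e = used-elim P f u in subst (λ v → 1 ≤ v × v ≤ q) e (bounded y)

  S-labels-used : AllLabels P (Used P f) S
  S-labels-used = slides-AllLabels P q (λ y v e → used-intro P f (initialContent-just e))

  Pro-unused-1 : ¬ Used P f 1 → ∀ x → suc (g x) ≡ f x
  Pro-unused-1 unused1 x = begin
    suc (g x)                  ≡⟨ cong suc (Pro-slides P q f x) ⟩
    suc (maybe (_∸ 1) q (S x)) ≡⟨ cong (suc ∘ maybe (_∸ 1) q) (slides-without-boxes P q f boxless x) ⟩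
    suc (f x ∸ 1)              ≡⟨ m+[n∸m]≡n (proj₁ (bounded x)) ⟩
    f x                        ∎
    where
    boxless : ∀ y → initialContent (f y) ≡ just (f y)
    boxless y = initialContent-≢1 (unused1 ∘ used-intro P f)

  deflate-Pro-unused-1 : ¬ Used P f 1 → ∀ x → deflate P (Pro P q f) x ≡ deflate P f x
  deflate-Pro-unused-1 unused1 x = begin
    deflate P g x                        ≡⟨ deflate-countUpTo P g x ⟩
    countUpTo (usedB P g) (g x)          ≡⟨ cong (_+ countUpTo (usedB P g) (g x)) rank-1≡0 ⟨
    rank 1 + countUpTo (usedB P g) (g x) ≡⟨ countUpTo-shift (usedB P g) (usedB P f) (g x) agree ⟩
    rank (suc (g x))                     ≡⟨ cong rank (Pro-unused-1 unused1 x) ⟩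
    rank (f x)                           ≡⟨ deflate-countUpTo P f x ⟨
    deflate P f x                        ∎
    where
    rank-1≡0 : rank 1 ≡ 0
    rank-1≡0 = countUpTo-suc-false (usedB P f) (¬-not unused1)
    agree : ∀ k → 1 ≤ k → k ≤ g x → usedB P g k ≡ usedB P f (suc k)
    agree k _ _ = usedB-suc P (Pro-unused-1 unused1) k

  Pro-used : ∀ k → 1 ≤ k → k < q → Used P g k ⇔ Used P f (suc k)
  Pro-used (suc k) _ k<q = mk⇔ forward backward
    where
    label-of : ∀ m → (∀ w → m ≡ just w → Used P f w) →
               maybe (_∸ 1) q m ≡ suc k → Used P f (suc (suc k))
    label-of nothing  _      q≡k   = ⊥-elim (<-irrefl (sym q≡k) k<q)
    label-of (just w) used-w w∸1≡k = subst (Used P f) w≡2+k (used-w w refl)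
      where
      w≡2+k : w ≡ suc (suc k)
      w≡2+k = trans (sym (m+[n∸m]≡n (proj₁ (used-bounded (used-w w refl))))) (cong suc w∸1≡k)

    forward : Used P g (suc k) → Used P f (suc (suc k))
    forward u = let y , e = used-elim P g u in
      label-of (S y) (S-labels-used y) (trans (sym (Pro-slides P q f y)) e)

    backward : Used P f (suc (suc k)) → Used P g (suc k)
    backward u =
      let y  , e  = used-elim P f u
          y′ , e′ = slides-label-kept P q (cong initialContent e)
      in used-intro P g (trans (Pro-slides P q f y′) (cong (maybe (_∸ 1) q) e′))

  module _ (used1 : Used P f 1) where

    rank-1 : rank 1 ≡ 1
    rank-1 = countUpTo-suc-true (usedB P f) used1

    slides-deflate : ∀ y → slides P (rank q) (initialContent ∘ deflate P f) y ≡ Maybe.map rank (S y)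
    slides-deflate = slides-relabel P (usedB P f) used1 initial-labels initial-relabel q
      where
      initial-labels : AllLabels P (Used P f) (initialContent ∘ f)
      initial-labels y v e = used-intro P f (initialContent-just e)

      rank≡1⇔ : ∀ {v} → Used P f v → rank v ≡ 1 ⇔ v ≡ 1
      rank≡1⇔ uv = mk⇔ (λ e → countUpTo-injective (usedB P f) uv used1 (trans e (sym rank-1)))
                       (λ { refl → rank-1 })

      initial-relabel : ∀ y → initialContent (deflate P f y) ≡ Maybe.map rank (initialContent (f y))
      initial-relabel y = trans (cong initialContent (deflate-countUpTo P f y))
                                (initialContent-relabel rank (rank≡1⇔ (used-intro P f refl)))

    countUpTo-Pro : ∀ k → k < q → suc (countUpTo (usedB P g) k) ≡ rank (suc k)
    countUpTo-Pro k k<q = trans (cong (_+ countUpTo (usedB P g) k) (sym rank-1))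
      (countUpTo-shift (usedB P g) (usedB P f) k
        (λ k′ 1≤k′ k′≤k → ≡true-ext (Pro-used k′ 1≤k′ (≤-<-trans k′≤k k<q))))

    countUpTo-Pro-≤ : ∀ m → m ≤ q → Used P g m → countUpTo (usedB P g) m ≡ rank m
    countUpTo-Pro-≤ zero    _   _ = refl
    countUpTo-Pro-≤ (suc m) m<q u = trans (countUpTo-suc-true (usedB P g) u) (countUpTo-Pro m m<q)

    deflate-Pro-used-1 : ∀ x → deflate P (Pro P q f) x ≡ Pro P (numUsed P q f) (deflate P f) x
    deflate-Pro-used-1 x = begin
        deflate P g x
      ≡⟨ deflate-countUpTo P g x ⟩
        countUpTo (usedB P g) (g x)
      ≡⟨ cong (countUpTo (usedB P g)) (Pro-slides P q f x) ⟩
        countUpTo (usedB P g) (maybe (_∸ 1) q (S x))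
      ≡⟨ by-final-content (S x) refl ⟩
        maybe (_∸ 1) (rank q) (Maybe.map rank (S x))
      ≡⟨ cong (maybe (_∸ 1) (rank q)) (slides-deflate x) ⟨
        maybe (_∸ 1) (rank q) (slides P (rank q) (initialContent ∘ deflate P f) x)
      ≡⟨ Pro-slides P (rank q) (deflate P f) x ⟨
        Pro P (rank q) (deflate P f) x
      ≡⟨ cong (λ r → Pro P r (deflate P f) x) (numUsed-countUpTo P q f) ⟨
        Pro P (numUsed P q f) (deflate P f) x
      ∎
      where
      by-final-content : ∀ m → S x ≡ m →
              countUpTo (usedB P g) (maybe (_∸ 1) q m) ≡ maybe (_∸ 1) (rank q) (Maybe.map rank m)
      by-final-content nothing  Sx =
        countUpTo-Pro-≤ q ≤-refl (used-intro P g (trans (Pro-slides P q f x) (cong (maybe (_∸ 1) q) Sx)))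
      by-final-content (just w) Sx = label w (used-bounded (S-labels-used x w Sx))
        where
        label : ∀ w → 1 ≤ w × w ≤ q → countUpTo (usedB P g) (w ∸ 1) ≡ rank w ∸ 1
        label (suc w) (_ , w<q) = cong (_∸ 1) (countUpTo-Pro w w<q)

proposition3p13 : (n : ℕ) (P : FinPoset n) (q : ℕ) (f : Fin n → ℕ) → Inc P q f →
    (Used P f 1 → ∀ x → deflate P (Pro P q f) x ≡ Pro P (numUsed P q f) (deflate P f) x)
    × (¬ Used P f 1 → ∀ x → deflate P (Pro P q f) x ≡ deflate P f x)
proposition3p13 n P q f (bounded , _) = deflate-Pro-used-1 P bounded , deflate-Pro-unused-1 P bounded
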